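{- Let $q\geq 2$, identify $Q=\{1,\ldots,q\}$, and let $T$ be a subset of $S_q$. Then the permutation code $C(T)$ in $H(q,q)$ is $1$-regular with minimum distance $\delta=2$ if and only if $T=S_q$.
   Context: $H(q,q)$ is the Hamming graph on $Q^q$ with Hamming distance. For $t\in S_q$, $\alpha(t)=(1^t,\ldots,q^t)$, and $C(T)=\{\alpha(t):t\in T\}$. The minimum distance of a code is the least distance between distinct codewords. For a code $C$, $C_i$ denotes the set of vertices at distance exactly $i$ from $C$ (distance to the nearest codeword), $\rho$ is the covering radius (maximal such distance); $C$ is $s$-regular (for $s\leq\rho$) if for every $i\in\{0,\ldots,s\}$, every $\gamma\in C_i$ and every $k\in\{0,\ldots,q\}$, the number of codewords at distance $k$ from $\gamma$ depends only on $i$ and $k$. -}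

module Defs where

open import Data.Nat using (ℕ; zero; suc; _≤_; _≟_)
open import Data.Fin using (Fin)
import Data.Fin as F
open import Data.Fin.Permutation using (Permutation′; _⟨$⟩ʳ_; _≈_)
open import Data.Vec using (Vec; []; _∷_; tabulate)
open import Data.Vec.Properties using (≡-dec)
open import Data.List using (List; []; _∷_; map; concatMap; filter; length)
open import Data.List.Relation.Unary.Any using (Any)
open import Data.Product using (Σ; ∃; _×_; _,_)
open import Relation.Nullary using (¬_; Dec; yes; no)
open import Relation.Nullary.Decidable using (_×-dec_)
open import Relation.Binary.PropositionalEquality using (_≡_; _≢_)
import Data.List.Membership.DecPropositional as DecMem

-- Vertices of the Hamming graph H(q,n): words of length n over Q = Fin q
Word : ℕ → ℕ → Set
Word q n = Vec (Fin q) n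

dist : ∀ {q n} → Word q n → Word q n → ℕ
dist [] [] = 0
dist (x ∷ xs) (y ∷ ys) with x F.≟ y
... | yes _ = dist xs ys
... | no _ = suc (dist xs ys)

allWords : ∀ q n → List (Word q n)
allWords q zero = [] ∷ []
allWords q (suc n) = concatMap (λ x → map (x ∷_) (allWords q n)) (Data.List.allFin q)
  where import Data.List

α : ∀ {q} → Permutation′ q → Word q q
α t = tabulate (λ i → t ⟨$⟩ʳ i)

-- the permutation code C(T), for T ⊆ S_q given as a (finite) list of permutations
C : ∀ {q} → List (Permutation′ q) → List (Word q q)
C T = map α T

module _ {q : ℕ} where
  open DecMem (≡-dec {n = q} (F._≟_ {q})) using (_∈_; _∈?_)

  -- a code in H(q,q) is a list of words (membership as a set)
  Code : Set
  Code = List (Word q q)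

  AtDist : Code → ℕ → Word q q → Set
  AtDist Cd i γ = (Σ (Word q q) λ c → c ∈ Cd × dist γ c ≡ i)
                × (∀ c → c ∈ Cd → i ≤ dist γ c)

  CovRadiusAtLeast : Code → ℕ → Set
  CovRadiusAtLeast Cd s = Σ (Word q q) λ γ → Σ ℕ λ i → s ≤ i × AtDist Cd i γ

  nAt : Code → Word q q → ℕ → ℕ
  nAt Cd γ k = length (filter (λ c → (c ∈? Cd) ×-dec (dist γ c ≟ k)) (allWords q q))

  Regular : ℕ → Code → Set
  Regular s Cd = CovRadiusAtLeast Cd s
    × (∀ i → i ≤ s → ∀ γ γ' → AtDist Cd i γ → AtDist Cd i γ' →
         ∀ k → k ≤ q → nAt Cd γ k ≡ nAt Cd γ' k)

  MinDist : Code → ℕ → Set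
  MinDist Cd δ = (Σ (Word q q) λ c → Σ (Word q q) λ c' →
                    c ∈ Cd × c' ∈ Cd × c ≢ c' × dist c c' ≡ δ)
               × (∀ c c' → c ∈ Cd → c' ∈ Cd → c ≢ c' → δ ≤ dist c c')

IsAll : ∀ {q} → List (Permutation′ q) → Set
IsAll {q} T = ∀ (σ : Permutation′ q) → Any (λ t → t ≈ σ) T

-- Two permutation words are never at distance 1, and α u, α (u ∘ (i j)) are at distance 2.
-- The maps w ↦ σ ∘ w ∘ τ are isometries of H(q,q) preserving C(S_q); they act transitively
-- on C(S_q) and on its neighbours, the words α u with entry i overwritten by entry j (i ≢ j),
-- so C(S_q) is 1-regular. Such a neighbour is at distance 1 from α u and α (u ∘ (i j)) and from
-- no other permutation word. Conversely, if δ = 2 then C(T) contains some α t and α (t ∘ (p p′)),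
-- so one neighbour has two codewords at distance 1; by regularity all of them do, hence C(T)
-- is closed under composition with transpositions, which generate S_q.

module Submission where

open import Defs
open import Data.Nat using (ℕ; _≤_)
open import Data.List using (List)
open import Data.Product using (_×_)
open import Data.Fin.Permutation using (Permutation′)
open import Function.Bundles using (_⇔_)

open import Data.Bool using (true; false)
open import Data.Fin as F using (Fin)
open import Data.Fin.Permutation
  using (_⟨$⟩ʳ_; _⟨$⟩ˡ_; inverseˡ; inverseʳ; _≈_; _∘ₚ_; id; flip; transpose)
open import Data.Fin.Permutation.Transposition.List using (eval; decompose; eval-decompose)
open import Data.List using ([]; _∷_; [_]; _++_; length; filter; map; concatMap; allFin; cartesianProductWith)
import Data.List as List
open import Data.List.Properties using (length-map; map-tabulate; filter-≐)
import Data.List.Membership.DecPropositional as DecMembership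
open import Data.List.Membership.Propositional using (_∈_)
open import Data.List.Membership.Propositional.Properties
  using (∈-map⁺; ∈-map⁻; ∈-filter⁺; ∈-filter⁻; ∈-allFin; ∈-cartesianProductWith⁺)
open import Data.List.Membership.Propositional.Properties.WithK using (unique∧set⇒bag)
open import Data.List.Relation.Binary.BagAndSetEquality using (_∼[_]_; set; ∼bag⇒↭)
open import Data.List.Relation.Binary.Permutation.Propositional.Properties using (↭-length)
open import Data.List.Relation.Unary.All using (All; []; _∷_)
open import Data.List.Relation.Unary.All.Properties using (All¬⇒¬Any; ¬Any⇒All¬)
open import Data.List.Relation.Unary.AllPairs using ([]; _∷_)
open import Data.List.Relation.Unary.Any as Any using (Any; here; there)
import Data.List.Relation.Unary.Any.Properties as Any
open import Data.List.Relation.Unary.Unique.Propositional using (Unique)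
open import Data.List.Relation.Unary.Unique.Propositional.Properties as Unique
  using (allFin⁺; cartesianProductWith⁺)
open import Data.Nat using (zero; suc; z≤n; s≤s; _≟_)
open import Data.Nat.Properties using (n≢0⇒n>0; ≤-refl; ≤-trans)
open import Data.Product using (∃; ∃₂; _,_; proj₂)
open import Data.Sum using (_⊎_; inj₁; inj₂)
open import Data.Vec as V using (Vec; lookup; tabulate; _[_]≔_)
open import Data.Vec.Properties
  using (∷-injective; lookup∘tabulate; tabulate∘lookup; tabulate-cong; ≡-dec; lookup∘update; lookup∘update′)
open import Function.Base using (_∘_; case_of_)
open import Function.Bundles using (_↔_; Inverse; mk⇔; mk↔ₛ′; Equivalence)
open import Relation.Binary.PropositionalEquality
  using (_≡_; _≢_; refl; sym; trans; cong; cong₂; subst; module ≡-Reasoning)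
open import Relation.Nullary using (yes; no; does; ¬?; contradiction)
open import Relation.Nullary.Decidable using (decidable-stable; dec-true; dec-false; _×-dec_)
open import Relation.Unary using (Pred; Decidable)

module _ {a} {A : Set a} where

  length-unique-set : {xs ys : List A} → Unique xs → Unique ys → xs ∼[ set ] ys →
                      length xs ≡ length ys
  length-unique-set xs! ys! xs∼ys = ↭-length (∼bag⇒↭ (unique∧set⇒bag xs! ys! xs∼ys))

  length≤1 : {xs : List A} {x : A} → Unique xs → (∀ {y} → y ∈ xs → y ≡ x) → length xs ≤ 1
  length≤1 {[]} _ _ = z≤n
  length≤1 {_ ∷ []} _ _ = s≤s z≤n
  length≤1 {_ ∷ _ ∷ _} ((y≢z ∷ _) ∷ _) ≡x =
    contradiction (trans (≡x (here refl)) (sym (≡x (there (here refl))))) y≢z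

  2≤length : {xs : List A} {x y : A} → x ∈ xs → y ∈ xs → x ≢ y → 2 ≤ length xs
  2≤length {_ ∷ _ ∷ _} _ _ _ = s≤s (s≤s z≤n)
  2≤length {_ ∷ []} (here refl) (here refl) x≢y = contradiction refl x≢y

  length≡1⇒ : {xs : List A} → length xs ≡ 1 → ∃ λ x → xs ≡ [ x ]
  length≡1⇒ {_ ∷ []} _ = _ , refl

  length≡2⇒ : {xs : List A} → length xs ≡ 2 → ∃₂ λ x y → xs ≡ x ∷ y ∷ []
  length≡2⇒ {_ ∷ _ ∷ []} _ = _ , _ , refl

  length-filter-map : ∀ {b p} {B : Set b} {P : Pred B p} (P? : Decidable P) (f : A → B) xs →
                      length (filter P? (map f xs)) ≡ length (filter (P? ∘ f) xs)
  length-filter-map P? f [] = refl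
  length-filter-map P? f (x ∷ xs) with does (P? (f x))
  ... | true = cong suc (length-filter-map P? f xs)
  ... | false = length-filter-map P? f xs

  module _ {xs : List A} (xs! : Unique xs) (complete : ∀ x → x ∈ xs) where

    length-filter-∘-↔ : ∀ {p} {P : Pred A p} (P? : Decidable P) (π : A ↔ A) →
                        length (filter (P? ∘ Inverse.to π) xs) ≡ length (filter P? xs)
    length-filter-∘-↔ {P = P} P? π = trans (sym (length-map to (filter (P? ∘ to) xs)))
      (length-unique-set (Unique.map⁺ injective (Unique.filter⁺ (P? ∘ to) xs!)) (Unique.filter⁺ P? xs!)
        (mk⇔ image⊆ ⊆image))
      where
      open Inverse π using (to; from; strictlyInverseˡ; strictlyInverseʳ)
      injective : ∀ {x y} → to x ≡ to y → x ≡ y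
      injective {x} {y} e = trans (sym (strictlyInverseʳ x)) (trans (cong from e) (strictlyInverseʳ y))
      image⊆ : ∀ {y} → y ∈ map to (filter (P? ∘ to) xs) → y ∈ filter P? xs
      image⊆ y∈ with x , x∈ , refl ← ∈-map⁻ to y∈ =
        ∈-filter⁺ P? (complete _) (proj₂ (∈-filter⁻ (P? ∘ to) {xs = xs} x∈))
      ⊆image : ∀ {y} → y ∈ filter P? xs → y ∈ map to (filter (P? ∘ to) xs)
      ⊆image {y} y∈ = subst (_∈ map to _) (strictlyInverseˡ y)
        (∈-map⁺ to (∈-filter⁺ (P? ∘ to) (complete (from y))
          (subst P (sym (strictlyInverseˡ y)) (proj₂ (∈-filter⁻ P? {xs = xs} y∈)))))

module _ {n : ℕ} where

  ⟨$⟩ʳ-injective : (s : Permutation′ n) {i j : Fin n} → s ⟨$⟩ʳ i ≡ s ⟨$⟩ʳ j → i ≡ j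
  ⟨$⟩ʳ-injective s e = trans (sym (inverseˡ s)) (trans (cong (s ⟨$⟩ˡ_) e) (inverseˡ s))

  transpose-matchˡ : (i j : Fin n) → transpose i j ⟨$⟩ʳ i ≡ j
  transpose-matchˡ i j rewrite dec-true (i F.≟ i) refl = refl

  transpose-matchʳ : (i j : Fin n) → transpose i j ⟨$⟩ʳ j ≡ i
  transpose-matchʳ i j with j F.≟ i
  ... | yes j≡i = j≡i
  ... | no _ rewrite dec-true (j F.≟ j) refl = refl

  transpose-mod : {i j k : Fin n} → k ≢ i → k ≢ j → transpose i j ⟨$⟩ʳ k ≡ k
  transpose-mod {i} {j} {k} k≢i k≢j rewrite dec-false (k F.≟ i) k≢i | dec-false (k F.≟ j) k≢j = refl

  transpose-self : (i : Fin n) → transpose i i ≈ id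
  transpose-self i k with k F.≟ i
  ... | yes k≡i = sym k≡i
  ... | no k≢i rewrite dec-false (k F.≟ i) k≢i = refl

  agree-except⇒≈ : (s s′ : Permutation′ n) (p : Fin n) →
                   (∀ k → k ≢ p → s ⟨$⟩ʳ k ≡ s′ ⟨$⟩ʳ k) → s ≈ s′
  agree-except⇒≈ s s′ p agree k with k F.≟ p
  ... | no k≢p = agree k k≢p
  ... | yes refl with s ⟨$⟩ˡ (s′ ⟨$⟩ʳ k) F.≟ k
  ...   | yes m≡k = trans (cong (s ⟨$⟩ʳ_) (sym m≡k)) (inverseʳ s)
  ...   | no m≢k = contradiction (⟨$⟩ʳ-injective s′ (trans (sym (agree _ m≢k)) (inverseʳ s))) m≢k

  pair-transitive : {p j p′ j′ : Fin n} → p ≢ j → p′ ≢ j′ →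
                    ∃ λ τ → τ ⟨$⟩ʳ p ≡ p′ × τ ⟨$⟩ʳ j ≡ j′
  pair-transitive {p} {j} {p′} {j′} p≢j p′≢j′ =
    transpose p p′ ∘ₚ transpose j₁ j′ ,
    trans (cong (transpose j₁ j′ ⟨$⟩ʳ_) (transpose-matchˡ p p′)) (transpose-mod p′≢j₁ p′≢j′) ,
    transpose-matchˡ j₁ j′
    where
    j₁ : Fin n
    j₁ = transpose p p′ ⟨$⟩ʳ j
    p′≢j₁ : p′ ≢ j₁
    p′≢j₁ e = p≢j (⟨$⟩ʳ-injective (transpose p p′) (trans (transpose-matchˡ p p′) e))

  transpositions-generate : ∀ {ℓ} (P : Pred (Permutation′ n) ℓ) →
                            (∀ {s s′} → s ≈ s′ → P s → P s′) →
                            (∀ {u i j} → i ≢ j → P u → P (transpose i j ∘ₚ u)) →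
                            ∀ {t} → P t → ∀ σ → P σ
  transpositions-generate P resp step {t} Pt σ = resp eval∘ₚt≈σ (eval-∘ₚ (decompose (σ ∘ₚ flip t)))
    where
    eval-∘ₚ : ∀ xs → P (eval xs ∘ₚ t)
    eval-∘ₚ [] = resp (λ _ → refl) Pt
    eval-∘ₚ ((i , j) ∷ xs) with i F.≟ j
    ... | yes refl = resp (λ k → cong (eval xs ∘ₚ t ⟨$⟩ʳ_) (sym (transpose-self i k))) (eval-∘ₚ xs)
    ... | no i≢j = resp (λ _ → refl) (step i≢j (eval-∘ₚ xs))
    eval∘ₚt≈σ : eval (decompose (σ ∘ₚ flip t)) ∘ₚ t ≈ σ
    eval∘ₚt≈σ k = trans (cong (t ⟨$⟩ʳ_) (eval-decompose (σ ∘ₚ flip t) k)) (inverseʳ t)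

concatMap-map≡cartesianProductWith : ∀ {a b c} {A : Set a} {B : Set b} {C : Set c}
                                     (f : A → B → C) xs ys →
                                     concatMap (λ x → map (f x) ys) xs ≡ cartesianProductWith f xs ys
concatMap-map≡cartesianProductWith f [] ys = refl
concatMap-map≡cartesianProductWith f (x ∷ xs) ys =
  cong (map (f x) ys ++_) (concatMap-map≡cartesianProductWith f xs ys)

module _ (q : ℕ) where

  allWords-unique : ∀ n → Unique (allWords q n)
  allWords-unique zero = [] ∷ []
  allWords-unique (suc n) rewrite concatMap-map≡cartesianProductWith V._∷_ (allFin q) (allWords q n) =
    cartesianProductWith⁺ V._∷_ ∷-injective (allFin⁺ q) (allWords-unique n)

  ∈-allWords : ∀ {n} (w : Word q n) → w ∈ allWords q n
  ∈-allWords V.[] = here refl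
  ∈-allWords {suc n} (x V.∷ w) rewrite concatMap-map≡cartesianProductWith V._∷_ (allFin q) (allWords q n) =
    ∈-cartesianProductWith⁺ V._∷_ (∈-allFin x) (∈-allWords w)

≗-lookup⇒≡ : ∀ {a} {A : Set a} {n} {u v : Vec A n} → (∀ i → lookup u i ≡ lookup v i) → u ≡ v
≗-lookup⇒≡ {u = u} {v} u≗v = trans (sym (tabulate∘lookup u)) (trans (tabulate-cong u≗v) (tabulate∘lookup v))

dist≡0⇒≡ : ∀ {q n} {u v : Word q n} → dist u v ≡ 0 → u ≡ v
dist≡0⇒≡ {u = V.[]} {V.[]} _ = refl
dist≡0⇒≡ {u = x V.∷ u} {y V.∷ v} d with x F.≟ y
... | yes refl = cong (x V.∷_) (dist≡0⇒≡ d)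
... | no _ = contradiction d (λ ())

differs? : ∀ {q n} (u v : Word q n) → Decidable (λ i → lookup u i ≢ lookup v i)
differs? u v i = ¬? (lookup u i F.≟ lookup v i)

disagreements : ∀ {q n} → Word q n → Word q n → List (Fin n)
disagreements {n = n} u v = filter (differs? u v) (allFin n)

length-disagreements-∷ : ∀ {q n} (x y : Fin q) (u v : Word q n) →
                         length (filter (differs? (x V.∷ u) (y V.∷ v)) (List.tabulate F.suc)) ≡
                         length (disagreements u v)
length-disagreements-∷ {n = n} x y u v =
  trans (cong (length ∘ filter (differs? (x V.∷ u) (y V.∷ v))) (sym (map-tabulate (λ i → i) F.suc)))
        (length-filter-map (differs? (x V.∷ u) (y V.∷ v)) F.suc (allFin n))

dist≡length-disagreements : ∀ {q n} (u v : Word q n) → dist u v ≡ length (disagreements u v)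
dist≡length-disagreements V.[] V.[] = refl
dist≡length-disagreements (x V.∷ u) (y V.∷ v) with x F.≟ y
... | yes _ = trans (dist≡length-disagreements u v) (sym (length-disagreements-∷ x y u v))
... | no _ = cong suc (trans (dist≡length-disagreements u v) (sym (length-disagreements-∷ x y u v)))

record DifferExactlyAt {q n} (u v : Word q n) (ps : List (Fin n)) : Set where
  field
    differ : ∀ {i} → i ∈ ps → lookup u i ≢ lookup v i
    agree  : ∀ {i} → All (i ≢_) ps → lookup u i ≡ lookup v i

module _ {q n : ℕ} (u v : Word q n) where
  open DecMembership (F._≟_ {n}) using (_∈?_)

  differExactlyAt-disagreements : DifferExactlyAt u v (disagreements u v)
  differExactlyAt-disagreements = record
    { differ = λ i∈ → proj₂ (∈-filter⁻ (differs? u v) {xs = allFin n} i∈)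
    ; agree  = λ {i} i∉ → decidable-stable (lookup u i F.≟ lookup v i)
                             (All¬⇒¬Any i∉ ∘ ∈-filter⁺ (differs? u v) (∈-allFin i))
    }

  dist≡length : {ps : List (Fin n)} → Unique ps → DifferExactlyAt u v ps → dist u v ≡ length ps
  dist≡length {ps} ps! u≠v = trans (dist≡length-disagreements u v)
    (length-unique-set (Unique.filter⁺ (differs? u v) (allFin⁺ n)) ps! (mk⇔ to from))
    where
    open DifferExactlyAt
    to : ∀ {i} → i ∈ disagreements u v → i ∈ ps
    to {i} i∈ with i ∈? ps
    ... | yes i∈ps = i∈ps
    ... | no i∉ps = contradiction (agree u≠v (¬Any⇒All¬ ps i∉ps)) (differ differExactlyAt-disagreements i∈)
    from : ∀ {i} → i ∈ ps → i ∈ disagreements u v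
    from {i} i∈ = ∈-filter⁺ (differs? u v) (∈-allFin i) (differ u≠v i∈)

  dist≡1 : {p : Fin n} → lookup u p ≢ lookup v p → (∀ {i} → i ≢ p → lookup u i ≡ lookup v i) →
           dist u v ≡ 1
  dist≡1 differ agree = dist≡length ([] ∷ []) record
    { differ = λ { (here refl) → differ }
    ; agree  = λ { (i≢p ∷ []) → agree i≢p }
    }

  dist≡2 : {p p′ : Fin n} → p ≢ p′ → lookup u p ≢ lookup v p → lookup u p′ ≢ lookup v p′ →
           (∀ {i} → i ≢ p → i ≢ p′ → lookup u i ≡ lookup v i) → dist u v ≡ 2
  dist≡2 p≢p′ differ differ′ agree = dist≡length ((p≢p′ ∷ []) ∷ [] ∷ []) record
    { differ = λ { (here refl) → differ ; (there (here refl)) → differ′ }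
    ; agree  = λ { (i≢p ∷ i≢p′ ∷ []) → agree i≢p i≢p′ }
    }

  dist≡1⇒ : dist u v ≡ 1 → ∃ λ p → DifferExactlyAt u v [ p ]
  dist≡1⇒ d with p , eq ← length≡1⇒ (trans (sym (dist≡length-disagreements u v)) d) =
    p , subst (DifferExactlyAt u v) eq differExactlyAt-disagreements

  dist≡2⇒ : dist u v ≡ 2 → ∃₂ λ p p′ → p ≢ p′ × DifferExactlyAt u v (p ∷ p′ ∷ [])
  dist≡2⇒ d with p , p′ , eq ← length≡2⇒ (trans (sym (dist≡length-disagreements u v)) d) =
    p , p′ , head-≢ (subst Unique eq (Unique.filter⁺ (differs? u v) (allFin⁺ n))) ,
    subst (DifferExactlyAt u v) eq differExactlyAt-disagreements
    where
    head-≢ : Unique (p ∷ p′ ∷ []) → p ≢ p′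
    head-≢ ((p≢p′ ∷ []) ∷ _) = p≢p′

module _ {q : ℕ} where

  lookup-α : (s : Permutation′ q) (i : Fin q) → lookup (α s) i ≡ s ⟨$⟩ʳ i
  lookup-α s = lookup∘tabulate (s ⟨$⟩ʳ_)

  α-cong : (s s′ : Permutation′ q) → s ≈ s′ → α s ≡ α s′
  α-cong s s′ = tabulate-cong

  α-injective : (s s′ : Permutation′ q) → α s ≡ α s′ → s ≈ s′
  α-injective s s′ e i = trans (sym (lookup-α s i)) (trans (cong (λ w → lookup w i) e) (lookup-α s′ i))

  dist-α≢1 : (s s′ : Permutation′ q) → dist (α s) (α s′) ≢ 1
  dist-α≢1 s s′ d with p , s≠s′ ← dist≡1⇒ (α s) (α s′) d =
    DifferExactlyAt.differ s≠s′ (here refl)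
      (cong (λ w → lookup w p) (α-cong s s′ (agree-except⇒≈ s s′ p agree)))
    where
    agree : ∀ k → k ≢ p → s ⟨$⟩ʳ k ≡ s′ ⟨$⟩ʳ k
    agree k k≢p = trans (sym (lookup-α s k)) (trans (DifferExactlyAt.agree s≠s′ (k≢p ∷ [])) (lookup-α s′ k))

  -- π ∘ₚ ρ applies π first, so α (transpose i j ∘ₚ u) is α u with the entries at i and j swapped.

  α≢α-transpose : (u : Permutation′ q) {i j : Fin q} → i ≢ j → α u ≢ α (transpose i j ∘ₚ u)
  α≢α-transpose u {i} {j} i≢j e = i≢j (⟨$⟩ʳ-injective u
    (trans (α-injective u (transpose i j ∘ₚ u) e i) (cong (u ⟨$⟩ʳ_) (transpose-matchˡ i j))))

  dist-α-transpose : (u : Permutation′ q) {i j : Fin q} → i ≢ j → dist (α u) (α (transpose i j ∘ₚ u)) ≡ 2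
  dist-α-transpose u {i} {j} i≢j = dist≡2 (α u) (α (transpose i j ∘ₚ u)) i≢j
    (differ-at (transpose-matchˡ i j) i≢j)
    (differ-at (transpose-matchʳ i j) (i≢j ∘ sym))
    (λ {k} k≢i k≢j → trans (lookup-α u k)
      (trans (cong (u ⟨$⟩ʳ_) (sym (transpose-mod k≢i k≢j))) (sym (lookup-α (transpose i j ∘ₚ u) k))))
    where
    differ-at : ∀ {k l} → transpose i j ⟨$⟩ʳ k ≡ l → k ≢ l →
                lookup (α u) k ≢ lookup (α (transpose i j ∘ₚ u)) k
    differ-at {k} τk≡l k≢l e = k≢l (⟨$⟩ʳ-injective u
      (trans (sym (lookup-α u k)) (trans e (trans (lookup-α (transpose i j ∘ₚ u) k) (cong (u ⟨$⟩ʳ_) τk≡l)))))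

  dist-α≡2⇒transpose : (t t′ : Permutation′ q) → dist (α t) (α t′) ≡ 2 →
                       ∃₂ λ p p′ → p ≢ p′ × t′ ≈ transpose p p′ ∘ₚ t
  dist-α≡2⇒transpose t t′ d with p , p′ , p≢p′ , t≠t′ ← dist≡2⇒ (α t) (α t′) d =
    p , p′ , p≢p′ , agree-except⇒≈ t′ (transpose p p′ ∘ₚ t) p′ agree-off-p′
    where
    agree : ∀ {k} → k ≢ p → k ≢ p′ → t ⟨$⟩ʳ k ≡ t′ ⟨$⟩ʳ k
    agree {k} k≢p k≢p′ =
      trans (sym (lookup-α t k)) (trans (DifferExactlyAt.agree t≠t′ (k≢p ∷ k≢p′ ∷ [])) (lookup-α t′ k))
    -- Pigeonhole: t′ p = t m for m = t⁻¹ (t′ p), and m ∉ {p, p′} would give t′ m = t m = t′ p.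
    t′p≡tp′ : t′ ⟨$⟩ʳ p ≡ t ⟨$⟩ʳ p′
    t′p≡tp′ with t ⟨$⟩ˡ (t′ ⟨$⟩ʳ p) F.≟ p′ | t ⟨$⟩ˡ (t′ ⟨$⟩ʳ p) F.≟ p
    ... | yes m≡p′ | _ = trans (sym (inverseʳ t)) (cong (t ⟨$⟩ʳ_) m≡p′)
    ... | no _ | yes m≡p = contradiction
      (trans (lookup-α t p) (trans (cong (t ⟨$⟩ʳ_) (sym m≡p)) (trans (inverseʳ t) (sym (lookup-α t′ p)))))
      (DifferExactlyAt.differ t≠t′ (here refl))
    ... | no m≢p′ | no m≢p =
      contradiction (⟨$⟩ʳ-injective t′ (trans (sym (agree m≢p m≢p′)) (inverseʳ t))) m≢p
    agree-off-p′ : ∀ k → k ≢ p′ → t′ ⟨$⟩ʳ k ≡ t ⟨$⟩ʳ (transpose p p′ ⟨$⟩ʳ k)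
    agree-off-p′ k k≢p′ = case k F.≟ p of λ where
      (yes refl) → trans t′p≡tp′ (cong (t ⟨$⟩ʳ_) (sym (transpose-matchˡ k p′)))
      (no k≢p)   → trans (sym (agree k≢p k≢p′)) (cong (t ⟨$⟩ʳ_) (sym (transpose-mod k≢p k≢p′)))

  neighbour : Permutation′ q → Fin q → Fin q → Word q q
  neighbour s i j = α s [ i ]≔ (s ⟨$⟩ʳ j)

  lookup-neighbour : (s : Permutation′ q) (i j : Fin q) → lookup (neighbour s i j) i ≡ s ⟨$⟩ʳ j
  lookup-neighbour s i j = lookup∘update i (α s) (s ⟨$⟩ʳ j)

  lookup-neighbour′ : (s : Permutation′ q) {i j k : Fin q} → k ≢ i → lookup (neighbour s i j) k ≡ s ⟨$⟩ʳ k
  lookup-neighbour′ s {i} {j} {k} k≢i = trans (lookup∘update′ k≢i (α s) (s ⟨$⟩ʳ j)) (lookup-α s k)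

  neighbour-cong : (s s′ : Permutation′ q) (i j : Fin q) → s ≈ s′ → neighbour s i j ≡ neighbour s′ i j
  neighbour-cong s s′ i j s≈s′ = cong₂ (λ w x → w [ i ]≔ x) (α-cong s s′ s≈s′) (s≈s′ j)

  neighbour-repeats : (u : Permutation′ q) {i j : Fin q} → i ≢ j →
                      lookup (neighbour u i j) i ≡ lookup (neighbour u i j) j
  neighbour-repeats u {i} {j} i≢j = trans (lookup-neighbour u i j) (sym (lookup-neighbour′ u (i≢j ∘ sym)))

  neighbour≢α : (u s : Permutation′ q) {i j : Fin q} → i ≢ j → neighbour u i j ≢ α s
  neighbour≢α u s {i} {j} i≢j γ≡α = i≢j (⟨$⟩ʳ-injective s (begin
    s ⟨$⟩ʳ i                   ≡⟨ lookup-α s i ⟨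
    lookup (α s) i             ≡⟨ cong (λ w → lookup w i) γ≡α ⟨
    lookup (neighbour u i j) i ≡⟨ neighbour-repeats u i≢j ⟩
    lookup (neighbour u i j) j ≡⟨ cong (λ w → lookup w j) γ≡α ⟩
    lookup (α s) j             ≡⟨ lookup-α s j ⟩
    s ⟨$⟩ʳ j                   ∎))
    where open ≡-Reasoning

  dist-neighbour-α : (u : Permutation′ q) {i j : Fin q} → i ≢ j → dist (neighbour u i j) (α u) ≡ 1
  dist-neighbour-α u {i} {j} i≢j = dist≡1 (neighbour u i j) (α u) {p = i}
    (λ e → i≢j (⟨$⟩ʳ-injective u (sym (trans (sym (lookup-neighbour u i j)) (trans e (lookup-α u i))))))
    (λ k≢i → trans (lookup-neighbour′ u k≢i) (sym (lookup-α u _)))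

  dist-neighbour-α-transpose : (u : Permutation′ q) {i j : Fin q} → i ≢ j →
                               dist (neighbour u i j) (α (transpose i j ∘ₚ u)) ≡ 1
  dist-neighbour-α-transpose u {i} {j} i≢j = dist≡1 (neighbour u i j) (α (transpose i j ∘ₚ u)) {p = j}
    (λ e → i≢j (⟨$⟩ʳ-injective u (begin
      u ⟨$⟩ʳ i                          ≡⟨ cong (u ⟨$⟩ʳ_) (transpose-matchʳ i j) ⟨
      u ⟨$⟩ʳ (transpose i j ⟨$⟩ʳ j)      ≡⟨ lookup-α (transpose i j ∘ₚ u) j ⟨
      lookup (α (transpose i j ∘ₚ u)) j ≡⟨ e ⟨
      lookup (neighbour u i j) j        ≡⟨ lookup-neighbour′ u (i≢j ∘ sym) ⟩
      u ⟨$⟩ʳ j                          ∎)))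
    agree
    where
    open ≡-Reasoning
    agree : ∀ {k} → k ≢ j → lookup (neighbour u i j) k ≡ lookup (α (transpose i j ∘ₚ u)) k
    agree {k} k≢j = trans (case k F.≟ i of λ where
        (yes refl) → trans (lookup-neighbour u k j) (cong (u ⟨$⟩ʳ_) (sym (transpose-matchˡ k j)))
        (no k≢i)   → trans (lookup-neighbour′ u k≢i) (cong (u ⟨$⟩ʳ_) (sym (transpose-mod k≢i k≢j))))
      (sym (lookup-α (transpose i j ∘ₚ u) k))

  dist-neighbour-α≡1⇒ : (u s : Permutation′ q) {i j : Fin q} → i ≢ j → dist (neighbour u i j) (α s) ≡ 1 →
                        s ≈ u ⊎ s ≈ transpose i j ∘ₚ u
  dist-neighbour-α≡1⇒ u s {i} {j} i≢j d with p , γ≠α ← dist≡1⇒ (neighbour u i j) (α s) d =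
    differing-position
    where
    agree : ∀ {k} → k ≢ p → lookup (neighbour u i j) k ≡ s ⟨$⟩ʳ k
    agree k≢p = trans (DifferExactlyAt.agree γ≠α (k≢p ∷ [])) (lookup-α s _)
    differing-position : s ≈ u ⊎ s ≈ transpose i j ∘ₚ u
    differing-position with p F.≟ i | p F.≟ j
    ... | yes refl | _ = inj₁ (agree-except⇒≈ s u p λ k k≢p →
      trans (sym (agree k≢p)) (lookup-neighbour′ u k≢p))
    ... | no p≢i | yes refl = inj₂ (agree-except⇒≈ s (transpose i p ∘ₚ u) p λ k k≢p →
      trans (sym (agree k≢p)) (case k F.≟ i of λ where
        (yes refl) → trans (lookup-neighbour u k p) (cong (u ⟨$⟩ʳ_) (sym (transpose-matchˡ k p)))
        (no k≢i)   → trans (lookup-neighbour′ u k≢i) (cong (u ⟨$⟩ʳ_) (sym (transpose-mod k≢i k≢p)))))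
    ... | no p≢i | no p≢j = contradiction (⟨$⟩ʳ-injective s (begin
      s ⟨$⟩ʳ i                   ≡⟨ agree (p≢i ∘ sym) ⟨
      lookup (neighbour u i j) i ≡⟨ neighbour-repeats u i≢j ⟩
      lookup (neighbour u i j) j ≡⟨ agree (p≢j ∘ sym) ⟩
      s ⟨$⟩ʳ j                   ∎)) i≢j
      where open ≡-Reasoning

  permute : Permutation′ q → Permutation′ q → Word q q → Word q q
  permute σ τ w = tabulate (λ i → σ ⟨$⟩ʳ lookup w (τ ⟨$⟩ʳ i))

  lookup-permute : (σ τ : Permutation′ q) (w : Word q q) (i : Fin q) →
                   lookup (permute σ τ w) i ≡ σ ⟨$⟩ʳ lookup w (τ ⟨$⟩ʳ i)
  lookup-permute σ τ w = lookup∘tabulate _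

  permute-α : (σ τ s : Permutation′ q) → permute σ τ (α s) ≡ α (τ ∘ₚ s ∘ₚ σ)
  permute-α σ τ s = tabulate-cong λ i → cong (σ ⟨$⟩ʳ_) (lookup-α s (τ ⟨$⟩ʳ i))

  permute-neighbour : (σ τ s : Permutation′ q) {p j p′ j′ : Fin q} →
                      τ ⟨$⟩ʳ p ≡ p′ → τ ⟨$⟩ʳ j ≡ j′ →
                      permute σ τ (neighbour s p′ j′) ≡ neighbour (τ ∘ₚ s ∘ₚ σ) p j
  permute-neighbour σ τ s {p} {j} refl refl = ≗-lookup⇒≡ λ k →
    trans (lookup-permute σ τ (neighbour s (τ ⟨$⟩ʳ p) (τ ⟨$⟩ʳ j)) k) (case k F.≟ p of λ where
      (yes refl) → trans (cong (σ ⟨$⟩ʳ_) (lookup-neighbour s _ _))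
                         (sym (lookup-neighbour (τ ∘ₚ s ∘ₚ σ) k j))
      (no k≢p)   → trans (cong (σ ⟨$⟩ʳ_) (lookup-neighbour′ s {j = τ ⟨$⟩ʳ j} (k≢p ∘ ⟨$⟩ʳ-injective τ)))
                         (sym (lookup-neighbour′ (τ ∘ₚ s ∘ₚ σ) {j = j} k≢p)))

  permute↔ : Permutation′ q → Permutation′ q → Word q q ↔ Word q q
  permute↔ σ τ = mk↔ₛ′ (permute σ τ) (permute (flip σ) (flip τ))
    (λ w → ≗-lookup⇒≡ λ i → trans (lookup-permute σ τ (permute (flip σ) (flip τ) w) i)
      (trans (cong (σ ⟨$⟩ʳ_) (lookup-permute (flip σ) (flip τ) w (τ ⟨$⟩ʳ i)))
             (trans (inverseʳ σ) (cong (lookup w) (inverseˡ τ)))))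
    (λ w → ≗-lookup⇒≡ λ i → trans (lookup-permute (flip σ) (flip τ) (permute σ τ w) i)
      (trans (cong (σ ⟨$⟩ˡ_) (lookup-permute σ τ w (τ ⟨$⟩ˡ i)))
             (trans (inverseˡ σ) (cong (lookup w) (inverseʳ τ)))))

  dist-permute : (σ τ : Permutation′ q) (u v : Word q q) → dist (permute σ τ u) (permute σ τ v) ≡ dist u v
  dist-permute σ τ u v = begin
    dist (permute σ τ u) (permute σ τ v)
      ≡⟨ dist≡length-disagreements (permute σ τ u) (permute σ τ v) ⟩
    length (filter (differs? (permute σ τ u) (permute σ τ v)) (allFin q))
      ≡⟨ cong length (filter-≐ _ _ (to , from) (allFin q)) ⟩
    length (filter (differs? u v ∘ (τ ⟨$⟩ʳ_)) (allFin q))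
      ≡⟨ length-filter-∘-↔ (allFin⁺ q) ∈-allFin (differs? u v) τ ⟩
    length (disagreements u v)
      ≡⟨ dist≡length-disagreements u v ⟨
    dist u v ∎
    where
    open ≡-Reasoning
    to : ∀ {i} → lookup (permute σ τ u) i ≢ lookup (permute σ τ v) i →
         lookup u (τ ⟨$⟩ʳ i) ≢ lookup v (τ ⟨$⟩ʳ i)
    to {i} ne e = ne (trans (lookup-permute σ τ u i) (trans (cong (σ ⟨$⟩ʳ_) e) (sym (lookup-permute σ τ v i))))
    from : ∀ {i} → lookup u (τ ⟨$⟩ʳ i) ≢ lookup v (τ ⟨$⟩ʳ i) →
           lookup (permute σ τ u) i ≢ lookup (permute σ τ v) i
    from {i} ne e = ne (⟨$⟩ʳ-injective σ (trans (sym (lookup-permute σ τ u i)) (trans e (lookup-permute σ τ v i))))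

  C₀-transitive : (s s′ : Permutation′ q) → ∃₂ λ σ τ → α s ≡ permute σ τ (α s′)
  C₀-transitive s s′ = flip s′ ∘ₚ s , id ,
    trans (α-cong s (s′ ∘ₚ flip s′ ∘ₚ s) λ k → cong (s ⟨$⟩ʳ_) (sym (inverseˡ s′)))
          (sym (permute-α (flip s′ ∘ₚ s) id s′))

  C₁-transitive : (s s′ : Permutation′ q) {p j p′ j′ : Fin q} → p ≢ j → p′ ≢ j′ →
                  ∃₂ λ σ τ → neighbour s p j ≡ permute σ τ (neighbour s′ p′ j′)
  C₁-transitive s s′ {p} {j} p≢j p′≢j′ with τ , τp , τj ← pair-transitive p≢j p′≢j′ =
    σ , τ , trans (neighbour-cong s (τ ∘ₚ s′ ∘ₚ σ) p j s≈) (sym (permute-neighbour σ τ s′ τp τj))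
    where
    σ : Permutation′ q
    σ = flip s′ ∘ₚ flip τ ∘ₚ s
    s≈ : s ≈ τ ∘ₚ s′ ∘ₚ σ
    s≈ k = cong (s ⟨$⟩ʳ_) (sym (trans (cong (τ ⟨$⟩ˡ_) (inverseˡ s′)) (inverseˡ τ)))

  open DecMembership (≡-dec {n = q} (F._≟_ {q})) using (_∈?_)

  atDistance? : (Cd : Code) (γ : Word q q) (k : ℕ) → Decidable (λ c → c ∈ Cd × dist γ c ≡ k)
  atDistance? Cd γ k c = (c ∈? Cd) ×-dec (dist γ c ≟ k)

  nAt≤1 : (Cd : Code) (γ : Word q q) {k : ℕ} (w : Word q q) →
          (∀ {c} → c ∈ Cd → dist γ c ≡ k → c ≡ w) → nAt Cd γ k ≤ 1
  nAt≤1 Cd γ {k} w only-w = length≤1 (Unique.filter⁺ (atDistance? Cd γ k) (allWords-unique q q))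
    λ c∈ → let (m , d) = proj₂ (∈-filter⁻ (atDistance? Cd γ k) {xs = allWords q q} c∈) in only-w m d

  2≤nAt : (Cd : Code) (γ : Word q q) {k : ℕ} {c c′ : Word q q} → c ≢ c′ →
          c ∈ Cd → c′ ∈ Cd → dist γ c ≡ k → dist γ c′ ≡ k → 2 ≤ nAt Cd γ k
  2≤nAt Cd γ {k} {c} {c′} c≢c′ c∈ c′∈ d d′ = 2≤length
    (∈-filter⁺ (atDistance? Cd γ k) (∈-allWords q c) (c∈ , d))
    (∈-filter⁺ (atDistance? Cd γ k) (∈-allWords q c′) (c′∈ , d′)) c≢c′

  nAt-permute : (σ τ : Permutation′ q) {Cd : Code} →
                (∀ {w} → w ∈ Cd → permute σ τ w ∈ Cd) → (∀ {w} → permute σ τ w ∈ Cd → w ∈ Cd) →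
                (γ : Word q q) (k : ℕ) → nAt Cd (permute σ τ γ) k ≡ nAt Cd γ k
  nAt-permute σ τ {Cd} preserve reflect γ k = begin
    nAt Cd (permute σ τ γ) k
      ≡⟨ length-filter-∘-↔ (allWords-unique q q) (∈-allWords q)
           (atDistance? Cd (permute σ τ γ) k) (permute↔ σ τ) ⟨
    length (filter (atDistance? Cd (permute σ τ γ) k ∘ permute σ τ) (allWords q q))
      ≡⟨ cong length (filter-≐ _ _ (to , from) (allWords q q)) ⟩
    nAt Cd γ k ∎
    where
    open ≡-Reasoning
    to : ∀ {c} → permute σ τ c ∈ Cd × dist (permute σ τ γ) (permute σ τ c) ≡ k →
         c ∈ Cd × dist γ c ≡ k
    to {c} (m , d) = reflect m , trans (sym (dist-permute σ τ γ c)) d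
    from : ∀ {c} → c ∈ Cd × dist γ c ≡ k →
           permute σ τ c ∈ Cd × dist (permute σ τ γ) (permute σ τ c) ≡ k
    from {c} (m , d) = preserve m , trans (dist-permute σ τ γ c) d

  module _ {T : List (Permutation′ q)} where

    ∈-C⁻ : {c : Word q q} → c ∈ C T → ∃ λ s → c ≡ α s
    ∈-C⁻ c∈ with s , _ , c≡α ← ∈-map⁻ α c∈ = s , c≡α

    α∈C⇔ : {s : Permutation′ q} → α s ∈ C T ⇔ Any (_≈ s) T
    α∈C⇔ {s} = mk⇔ (Any.map (λ {t} e → α-injective t s (sym e)) ∘ Any.map⁻)
                   (Any.map⁺ ∘ Any.map (λ {t} t≈s → sym (α-cong t s t≈s)))

    atDist0⇒α : {γ : Word q q} → AtDist (C T) 0 γ → ∃ λ s → γ ≡ α s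
    atDist0⇒α ((c , c∈ , d) , _) with s , refl ← ∈-C⁻ c∈ = s , dist≡0⇒≡ d

    atDist1⇒neighbour : {γ : Word q q} → AtDist (C T) 1 γ →
                        ∃ λ s → ∃₂ λ p j → p ≢ j × γ ≡ neighbour s p j
    atDist1⇒neighbour {γ} ((c , c∈ , d) , _)
      with s , refl ← ∈-C⁻ c∈
      with p , γ≠α ← dist≡1⇒ γ (α s) d =
      s , p , j , p≢j , ≗-lookup⇒≡ λ k → case k F.≟ p of λ where
        (yes refl) → trans (sym (inverseʳ s)) (sym (lookup-neighbour s k j))
        (no k≢p)   → trans (agree-off k≢p) (sym (lookup-neighbour′ s k≢p))
      where
      open DifferExactlyAt γ≠α
      j : Fin q
      j = s ⟨$⟩ˡ lookup γ p
      agree-off : ∀ {k} → k ≢ p → lookup γ k ≡ s ⟨$⟩ʳ k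
      agree-off k≢p = trans (agree (k≢p ∷ [])) (lookup-α s _)
      p≢j : p ≢ j
      p≢j p≡j = differ (here refl)
        (trans (sym (inverseʳ s)) (trans (cong (s ⟨$⟩ʳ_) (sym p≡j)) (sym (lookup-α s p))))

    neighbour-atDist1 : (u : Permutation′ q) {i j : Fin q} → α u ∈ C T → i ≢ j →
                        AtDist (C T) 1 (neighbour u i j)
    neighbour-atDist1 u u∈ i≢j = (α u , u∈ , dist-neighbour-α u i≢j) , λ c c∈ → nonzero (∈-C⁻ c∈)
      where
      nonzero : ∀ {c} → (∃ λ s → c ≡ α s) → 1 ≤ dist (neighbour u _ _) c
      nonzero (s , refl) = n≢0⇒n>0 (neighbour≢α u s i≢j ∘ dist≡0⇒≡)

    module _ (all : IsAll T) where

      α∈C : (s : Permutation′ q) → α s ∈ C T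
      α∈C s = Equivalence.from (α∈C⇔ {s}) (all s)

      permute-∈C : (σ τ : Permutation′ q) {w : Word q q} → w ∈ C T → permute σ τ w ∈ C T
      permute-∈C σ τ w∈ with s , refl ← ∈-C⁻ w∈ =
        subst (_∈ C T) (sym (permute-α σ τ s)) (α∈C (τ ∘ₚ s ∘ₚ σ))

      nAt-permute-invariant : (σ τ : Permutation′ q) (γ γ′ : Word q q) → γ ≡ permute σ τ γ′ →
                              (k : ℕ) → nAt (C T) γ k ≡ nAt (C T) γ′ k
      nAt-permute-invariant σ τ _ γ′ refl k = nAt-permute σ τ (permute-∈C σ τ)
        (λ {w} m → subst (_∈ C T) (Inverse.strictlyInverseʳ (permute↔ σ τ) w) (permute-∈C (flip σ) (flip τ) m))
        γ′ k

      all⇒regular : {a b : Fin q} → a ≢ b → Regular 1 (C T)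
      all⇒regular {a} {b} a≢b = (neighbour id a b , 1 , ≤-refl , neighbour-atDist1 id (α∈C id) a≢b) , regular
        where
        regular : ∀ i → i ≤ 1 → ∀ γ γ′ → AtDist (C T) i γ → AtDist (C T) i γ′ →
                  ∀ k → k ≤ q → nAt (C T) γ k ≡ nAt (C T) γ′ k
        regular 0 _ γ γ′ γ∈C₀ γ′∈C₀ k _
          with s , refl ← atDist0⇒α {γ} γ∈C₀ | s′ , refl ← atDist0⇒α {γ′} γ′∈C₀
          with σ , τ , γ≡ ← C₀-transitive s s′ = nAt-permute-invariant σ τ (α s) (α s′) γ≡ k
        regular 1 _ γ γ′ γ∈C₁ γ′∈C₁ k _
          with s , p , j , p≢j , refl ← atDist1⇒neighbour {γ} γ∈C₁
             | s′ , p′ , j′ , p′≢j′ , refl ← atDist1⇒neighbour {γ′} γ′∈C₁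
          with σ , τ , γ≡ ← C₁-transitive s s′ p≢j p′≢j′ =
          nAt-permute-invariant σ τ (neighbour s p j) (neighbour s′ p′ j′) γ≡ k
        regular (suc (suc _)) (s≤s ())

      all⇒minDist2 : {a b : Fin q} → a ≢ b → MinDist (C T) 2
      all⇒minDist2 {a} {b} a≢b =
        (α id , α (transpose a b ∘ₚ id) , α∈C id , α∈C (transpose a b ∘ₚ id) ,
         α≢α-transpose id a≢b , dist-α-transpose id a≢b) ,
        separated
        where
        2≤ : ∀ {n} → n ≢ 0 → n ≢ 1 → 2 ≤ n
        2≤ {0} n≢0 _ = contradiction refl n≢0
        2≤ {1} _ n≢1 = contradiction refl n≢1
        2≤ {suc (suc _)} _ _ = s≤s (s≤s z≤n)
        separated : ∀ c c′ → c ∈ C T → c′ ∈ C T → c ≢ c′ → 2 ≤ dist c c′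
        separated c c′ c∈ c′∈ c≢c′ with s , refl ← ∈-C⁻ c∈ | s′ , refl ← ∈-C⁻ c′∈ =
          2≤ (c≢c′ ∘ dist≡0⇒≡) (dist-α≢1 s s′)

    module _ (1≤q : 1 ≤ q) (regular : Regular 1 (C T)) where

      transpose-closed : (t : Permutation′ q) {p p′ : Fin q} → p ≢ p′ →
                         α t ∈ C T → α (transpose p p′ ∘ₚ t) ∈ C T →
                         ∀ {u i j} → i ≢ j → α u ∈ C T → α (transpose i j ∘ₚ u) ∈ C T
      transpose-closed t {p} {p′} p≢p′ t∈ t′∈ {u} {i} {j} i≢j u∈ with α (transpose i j ∘ₚ u) ∈? C T
      ... | yes u′∈ = u′∈
      ... | no u′∉ = contradiction (≤-trans two-near-t (subst (_≤ 1) (sym same-count) one-near-u)) λ { (s≤s ()) }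
        where
        same-count : nAt (C T) (neighbour t p p′) 1 ≡ nAt (C T) (neighbour u i j) 1
        same-count = proj₂ regular 1 ≤-refl (neighbour t p p′) (neighbour u i j)
          (neighbour-atDist1 t t∈ p≢p′) (neighbour-atDist1 u u∈ i≢j) 1 1≤q
        two-near-t : 2 ≤ nAt (C T) (neighbour t p p′) 1
        two-near-t = 2≤nAt (C T) (neighbour t p p′) (α≢α-transpose t p≢p′) t∈ t′∈
          (dist-neighbour-α t p≢p′) (dist-neighbour-α-transpose t p≢p′)
        only-u : ∀ {c} → c ∈ C T → dist (neighbour u i j) c ≡ 1 → c ≡ α u
        only-u c∈ d with s , refl ← ∈-C⁻ c∈ with dist-neighbour-α≡1⇒ u s i≢j d
        ... | inj₁ s≈u = α-cong s u s≈u
        ... | inj₂ s≈u′ = contradiction (subst (_∈ C T) (α-cong s (transpose i j ∘ₚ u) s≈u′) c∈) u′∉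
        one-near-u : nAt (C T) (neighbour u i j) 1 ≤ 1
        one-near-u = nAt≤1 (C T) (neighbour u i j) (α u) only-u

      regular∧minDist2⇒all : MinDist (C T) 2 → IsAll T
      regular∧minDist2⇒all ((_ , _ , c∈ , c′∈ , _ , d) , _)
        with t , refl ← ∈-C⁻ c∈ | t′ , refl ← ∈-C⁻ c′∈
        with p , p′ , p≢p′ , t′≈ ← dist-α≡2⇒transpose t t′ d = λ σ →
        Equivalence.to (α∈C⇔ {σ}) (transpositions-generate (λ s → α s ∈ C T)
          (λ {s} {s′} s≈s′ → subst (_∈ C T) (α-cong s s′ s≈s′))
          (λ {u} → transpose-closed t p≢p′ c∈ tp∈ {u}) {t} c∈ σ)
        where
        tp∈ : α (transpose p p′ ∘ₚ t) ∈ C T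
        tp∈ = subst (_∈ C T) (α-cong t′ (transpose p p′ ∘ₚ t) t′≈) c′∈

lemma5p2 : (q : ℕ) → 2 ≤ q → (T : List (Permutation′ q)) →
    (Regular 1 (C T) × MinDist (C T) 2) ⇔ IsAll T
lemma5p2 (suc (suc q)) _ T = mk⇔
  (λ (regular , minDist) → regular∧minDist2⇒all (s≤s z≤n) regular minDist)
  (λ all → all⇒regular all 0≢1 , all⇒minDist2 all 0≢1)
  where
  0≢1 : F.zero ≢ F.suc F.zero
  0≢1 ()
lemma5p2 (suc zero) (s≤s ()) T
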